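{- Let $m\ge1$ and let $G^c=(V,E)$ be the cocktail party graph on $n=2m$ vertices, i.e. the graph obtained from $K_{2m}$ by deleting the edges of a perfect matching. For every coloring of the edges of $G^c$ with two colors, there is a color $i\in\{1,2\}$ and a subset $S\subseteq V$ with $|S|\ge n/2$ such that $S$ is a 2-reachable subset of $G^c_i$.
   Context: $G^c_i$ denotes the spanning subgraph of $G^c$ consisting of all edges of color $i$. A subset $X$ of the vertex set of a graph $H$ is a 2-reachable subset of $H$ if any two vertices of $X$ are at distance at most two in $H$ (the connecting path may use vertices outside $X$). -}

module Defs where

open import Data.Nat using (ℕ)
open import Data.Fin using (Fin)
open import Data.Bool using (Bool)
open import Data.Product using (_×_; ∃-syntax; proj₁)
open import Data.Sum using (_⊎_)
open import Relation.Binary.PropositionalEquality using (_≡_; _≢_)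

-- Vertex set of the cocktail party graph on n = 2m vertices:
-- vertex (k , b) ; the deleted perfect matching is {(k,false),(k,true)}.
Vertex : ℕ → Set
Vertex m = Fin m × Bool

Adj : {m : ℕ} → Vertex m → Vertex m → Set
Adj u v = proj₁ u ≢ proj₁ v

record Colouring (m : ℕ) : Set where
  field
    col  : (u v : Vertex m) → Adj u v → Fin 2
    symm : (u v : Vertex m) (p : Adj u v) (q : Adj v u) → col u v p ≡ col v u q
open Colouring public

AdjCol : {m : ℕ} → Colouring m → Fin 2 → Vertex m → Vertex m → Set
AdjCol c i u v = ∃[ p ] (col c u v p ≡ i)

Dist≤2 : {m : ℕ} → Colouring m → Fin 2 → Vertex m → Vertex m → Set
Dist≤2 c i u v = (u ≡ v) ⊎ (AdjCol c i u v ⊎ (∃[ w ] (AdjCol c i u w × AdjCol c i w v)))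

TwoReachable : {m : ℕ} → Colouring m → Fin 2 → (Vertex m → Set) → Set
TwoReachable c i X = ∀ u v → X u → X v → Dist≤2 c i u v

-- Fix a vertex x. Its 2m − 2 neighbours in G^c split into two colour classes, so one colour i
-- has at least m − 1 of them; x together with its i-coloured neighbours has at least m vertices,
-- and any two of them are joined in G^c_i through x.
module Submission where

open import Defs
open import Data.Nat using (ℕ; suc; _≥_)
open import Data.Fin using (Fin)
open import Data.List using (List; length)
open import Data.List.Relation.Unary.Unique.Propositional using (Unique)
open import Data.List.Membership.Propositional using (_∈_)
open import Data.Product using (_×_; ∃-syntax)

open import Data.Nat using (_+_; _*_; _≤_; _≤?_; s≤s)
open import Data.Nat.Properties using (+-suc; +-mono-<; <-irrefl; ≰⇒>; *-comm; +-identityʳ)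
open import Data.Fin.Patterns using (0F; 1F)
open import Data.Fin.Properties using (_≟_)
open import Data.Bool using (Bool; true; false)
open import Data.List using ([]; _∷_; _++_; map; filter; cartesianProduct; allFin)
open import Data.List.Properties using (length-map; length-++; length-tabulate)
open import Data.List.Relation.Unary.Any using (here; there)
import Data.List.Relation.Unary.All as All
import Data.List.Relation.Unary.All.Properties as All
import Data.List.Relation.Unary.AllPairs as AllPairs
import Data.List.Relation.Unary.Unique.Propositional.Properties as Unique
open import Data.List.Membership.Propositional.Properties using (∈-map⁻; ∈-filter⁻)
open import Data.Product using (_,_; proj₂)
open import Data.Sum using (_⊎_; inj₁; inj₂)
open import Data.Empty using (⊥-elim)
open import Relation.Nullary using (yes; no)
open import Relation.Binary.PropositionalEquality using (_≡_; _≢_; refl; sym; trans; cong; cong₂; subst; module ≡-Reasoning)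

length-cartesianProduct : {A B : Set} (xs : List A) (ys : List B) →
  length (cartesianProduct xs ys) ≡ length xs * length ys
length-cartesianProduct []       ys = refl
length-cartesianProduct (x ∷ xs) ys = begin
  length (map (x ,_) ys ++ cartesianProduct xs ys)         ≡⟨ length-++ (map (x ,_) ys) ⟩
  length (map (x ,_) ys) + length (cartesianProduct xs ys) ≡⟨ cong₂ _+_ (length-map (x ,_) ys)
                                                                        (length-cartesianProduct xs ys) ⟩
  length ys + length xs * length ys                        ∎
  where open ≡-Reasoning

m+n≡o+o⇒o≤m⊎o≤n : ∀ {m n o} → m + n ≡ o + o → o ≤ m ⊎ o ≤ n
m+n≡o+o⇒o≤m⊎o≤n {m} {n} {o} m+n≡o+o with o ≤? m | o ≤? n
... | yes o≤m | _       = inj₁ o≤m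
... | no _    | yes o≤n = inj₂ o≤n
... | no o≰m  | no o≰n  = ⊥-elim (<-irrefl m+n≡o+o (+-mono-< (≰⇒> o≰m) (≰⇒> o≰n)))

module _ {A : Set} (f : A → Fin 2) where

  ColourClass : Fin 2 → List A → List A
  ColourClass i = filter (λ a → f a ≟ i)

  length-colourClasses : (xs : List A) →
    length (ColourClass 0F xs) + length (ColourClass 1F xs) ≡ length xs
  length-colourClasses []       = refl
  length-colourClasses (a ∷ xs) with f a
  ... | 0F = cong suc (length-colourClasses xs)
  ... | 1F = trans (+-suc _ _) (cong suc (length-colourClasses xs))

  majorityColour : ∀ k (xs : List A) → length xs ≡ k + k → ∃[ i ] k ≤ length (ColourClass i xs)
  majorityColour k xs len≡k+k with m+n≡o+o⇒o≤m⊎o≤n (trans (length-colourClasses xs) len≡k+k)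
  ... | inj₁ k≤c₀ = 0F , k≤c₀
  ... | inj₂ k≤c₁ = 1F , k≤c₁

module _ {m : ℕ} (c : Colouring m) {i : Fin 2} where

  AdjCol-sym : ∀ {u v} → AdjCol c i u v → AdjCol c i v u
  AdjCol-sym {u} {v} (u~v , colour≡i) = v~u , trans (sym (symm c u v u~v v~u)) colour≡i
    where
    v~u : Adj v u
    v~u = λ eq → u~v (sym eq)

  closedNeighbourhood-twoReachable : (x : Vertex m) {X : Vertex m → Set} →
    (∀ {v} → X v → v ≡ x ⊎ AdjCol c i x v) → TwoReachable c i X
  closedNeighbourhood-twoReachable x X⊆N[x] u v u∈X v∈X with X⊆N[x] u∈X | X⊆N[x] v∈X
  ... | inj₁ refl | inj₁ refl = inj₁ refl
  ... | inj₁ refl | inj₂ x~v  = inj₂ (inj₁ x~v)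
  ... | inj₂ x~u  | inj₁ refl = inj₂ (inj₁ (AdjCol-sym x~u))
  ... | inj₂ x~u  | inj₂ x~v  = inj₂ (inj₂ (x , AdjCol-sym x~u , x~v))

module StarsAtCentre {k : ℕ} (c : Colouring (suc k)) where

  centre : Vertex (suc k)
  centre = 0F , false

  outer : Fin k × Bool → Vertex (suc k)
  outer (j , b) = Data.Fin.suc j , b

  outer-injective : ∀ {p q} → outer p ≡ outer q → p ≡ q
  outer-injective refl = refl

  centre~outer : ∀ p → Adj centre (outer p)
  centre~outer p ()

  outerColour : Fin k × Bool → Fin 2
  outerColour p = col c centre (outer p) (centre~outer p)

  outerIndices : List (Fin k × Bool)
  outerIndices = cartesianProduct (allFin k) (false ∷ true ∷ [])

  length-outerIndices : length outerIndices ≡ k + k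
  length-outerIndices = begin
    length outerIndices    ≡⟨ length-cartesianProduct (allFin k) (false ∷ true ∷ []) ⟩
    length (allFin k) * 2  ≡⟨ cong (_* 2) (length-tabulate {n = k} (λ j → j)) ⟩
    k * 2                  ≡⟨ *-comm k 2 ⟩
    k + (k + 0)            ≡⟨ cong (k +_) (+-identityʳ k) ⟩
    k + k                  ∎
    where open ≡-Reasoning

  unique-outerIndices : Unique outerIndices
  unique-outerIndices = Unique.cartesianProduct⁺ (Unique.allFin⁺ k) unique-bools
    where
    unique-bools : Unique (false ∷ true ∷ [])
    unique-bools = ((λ ()) All.∷ All.[]) AllPairs.∷ All.[] AllPairs.∷ AllPairs.[]

  star : Fin 2 → List (Vertex (suc k))
  star i = centre ∷ map outer (ColourClass outerColour i outerIndices)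

  length-star : ∀ i → length (star i) ≡ suc (length (ColourClass outerColour i outerIndices))
  length-star i = cong suc (length-map outer (ColourClass outerColour i outerIndices))

  unique-star : ∀ i → Unique (star i)
  unique-star i = All.map⁺ (All.universal centre≢outer _)
    AllPairs.∷ Unique.map⁺ outer-injective
                 (Unique.filter⁺ (λ p → outerColour p ≟ i) {xs = outerIndices} unique-outerIndices)
    where
    centre≢outer : ∀ p → centre ≢ outer p
    centre≢outer p ()

  star⊆closedNeighbourhood : ∀ i {v} → v ∈ star i → v ≡ centre ⊎ AdjCol c i centre v
  star⊆closedNeighbourhood i (here refl) = inj₁ refl
  star⊆closedNeighbourhood i (there v∈) with ∈-map⁻ outer v∈
  ... | p , p∈ , refl =
    inj₂ (centre~outer p , proj₂ (∈-filter⁻ (λ p → outerColour p ≟ i) {xs = outerIndices} p∈))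

corollary4 : (k : ℕ) → let m = suc k in (c : Colouring m) →
    ∃[ i ] ∃[ S ] (Unique S × length S ≥ m × TwoReachable c i (λ v → v ∈ S))
corollary4 k c =
  let open StarsAtCentre c
      (i , k≤class) = majorityColour outerColour k outerIndices length-outerIndices
  in i , star i , unique-star i , subst (_≥ suc k) (sym (length-star i)) (s≤s k≤class)
       , closedNeighbourhood-twoReachable c centre (star⊆closedNeighbourhood i)
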